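{- Let $a,b$ be integers with $a-1>b\ge 1$, let $\varphi(0)=0^a1$, $\varphi(1)=0^b1$, let $u_\beta=\lim_{n\to\infty}\varphi^n(0)$, let $T(w)=0^b1\varphi(w)0^b$, and define $U^{(1)}=0^{a-1}$, $U^{(n)}=T(U^{(n-1)})$, $V^{(1)}=0^b$, $V^{(n)}=T(V^{(n-1)})$ for $n\ge 2$. Let $p$ be a palindrome in ${\cal L}(u_\beta)$. Then: (1) $p$ is a maximal palindrome if and only if $p=U^{(n)}$ for some positive integer $n$; (2) $p$ has two palindromic extensions if and only if $p=V^{(n)}$ for some positive integer $n$; (3) $p$ has exactly one palindromic extension if and only if $p\neq U^{(n)}$ and $p\ne V^{(n)}$ for all positive integers $n$.
   Context: ${\cal L}(u_\beta)$ is the set of finite factors of $u_\beta$. A word is a palindrome if it equals its reversal. A letter $z\in\{0,1\}$ is a palindromic extension of a palindrome $p$ if $zpz\in{\cal L}(u_\beta)$. A palindrome is maximal if it has no palindromic extension. -}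

module Defs where

open import Data.Bool using (Bool; true; false)
open import Data.Nat using (ℕ; zero; suc; _+_; _∸_)
open import Data.List using (List; []; _∷_; _++_; replicate; concatMap; length; map; upTo; reverse; [_])
open import Data.Product using (∃-syntax; _×_)
open import Relation.Binary.PropositionalEquality using (_≡_)
open import Relation.Nullary using (¬_)

-- Letters: false stands for the letter 0, true for the letter 1.
Letter : Set
Letter = Bool

Word : Set
Word = List Letter

φ : ℕ → ℕ → Letter → Word
φ a b false = replicate a false ++ [ true ]
φ a b true  = replicate b false ++ [ true ]

φ* : ℕ → ℕ → Word → Word
φ* a b = concatMap (φ a b)

φⁿ0 : ℕ → ℕ → ℕ → Word
φⁿ0 a b zero    = [ false ]
φⁿ0 a b (suc n) = φ* a b (φⁿ0 a b n)

at : Word → ℕ → Letter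
at []       _       = false
at (x ∷ w)  zero    = x
at (x ∷ w)  (suc i) = at w i

-- u_β = lim φ^n(0): its i-th letter is the i-th letter of φ^{i+1}(0)
-- (|φ^{i+1}(0)| ≥ 2^{i+1} > i, and φ^n(0) is a prefix of φ^{n+1}(0))
u : ℕ → ℕ → ℕ → Letter
u a b i = at (φⁿ0 a b (suc i)) i

Factor : ℕ → ℕ → Word → Set
Factor a b w = ∃[ k ] (w ≡ map (λ j → u a b (k + j)) (upTo (length w)))

IsPalindrome : Word → Set
IsPalindrome p = reverse p ≡ p

PalExt : ℕ → ℕ → Letter → Word → Set
PalExt a b z p = Factor a b (z ∷ p ++ [ z ])

Maximal : ℕ → ℕ → Word → Set
Maximal a b p = ¬ (∃[ z ] PalExt a b z p)

T : ℕ → ℕ → Word → Word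
T a b w = replicate b false ++ [ true ] ++ φ* a b w ++ replicate b false

-- U^{(n)} and V^{(n)} for n ≥ 1 (index 0 is an unused dummy value [])
U : ℕ → ℕ → ℕ → Word
U a b zero          = []
U a b (suc zero)    = replicate (a ∸ 1) false
U a b (suc (suc n)) = T a b (U a b (suc n))

V : ℕ → ℕ → ℕ → Word
V a b zero          = []
V a b (suc zero)    = replicate b false
V a b (suc (suc n)) = T a b (V a b (suc n))

-- The argument rests on recognizability of φ: every letter 1 of φ(s) closes the image
-- φ(c) = 0^k 1 of a letter c of s, where k = zeroRun c is a or b.  Hence a palindrome p
-- of 𝓛(u_β) is either 0^m with m ≤ a, or p = 0^i 1 φ(w) 0^i for a shorter palindrome w
-- having an occurrence c w d with i ≤ zeroRun c, zeroRun d.  Then 0p0 occurs iff this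
-- holds with i + 1, and 1p1 occurs only if i ∈ {a, b}.  So for i ≠ b the palindrome p has
-- exactly one extension (0 if i < a, 1 if i = a) and is no U⁽ⁿ⁾ or V⁽ⁿ⁾, while for i = b
-- it is T(w) and inherits the extensions of w as well as its membership in the T-orbits
-- U⁽ⁿ⁾ = Tⁿ⁻¹(0^(a-1)) and V⁽ⁿ⁾ = Tⁿ⁻¹(0^b).  Induction on |p| reduces everything to the
-- palindromes 0^m.

module Submission where

open import Defs
open import Data.Bool using (true; false)
open import Data.Empty using (⊥-elim)
open import Data.List using ([]; _∷_; _++_; _∷ʳ_; replicate; length; applyUpTo; reverse; [_])
open import Data.List.Properties
open import Data.Nat using (ℕ; zero; suc; _+_; _∸_; _≤_; _<_; z≤n; s≤s; _≤′_; ≤′-refl; ≤′-step)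
open import Data.Nat.Induction using (<-wellFounded)
open import Data.Nat.Properties
open import Data.Product using (∃-syntax; _×_; _,_; proj₁; proj₂)
open import Data.Product.Function.NonDependent.Propositional using (_×-⇔_)
open import Data.Sum using (_⊎_; inj₁; inj₂)
import Data.Sum as Sum
open import Data.Sum.Function.Propositional using (_⊎-⇔_)
open import Function using (_∘_)
open import Function.Bundles using (_⇔_; mk⇔; Equivalence)
open import Function.Properties.Equivalence using () renaming (refl to ⇔-refl; sym to ⇔-sym; trans to ⇔-trans)
open import Function.Related.TypeIsomorphisms using (¬-cong-⇔)
open import Induction.WellFounded using (Acc; acc)
open import Relation.Binary.Definitions using (tri<; tri≈; tri>)
open import Relation.Binary.PropositionalEquality hiding ([_])
open import Relation.Nullary using (¬_; yes; no)

0^_ : ℕ → Word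
0^ n = replicate n false

0^-+ : ∀ m n → 0^ m ++ 0^ n ≡ 0^ (m + n)
0^-+ zero    n = refl
0^-+ (suc m) n = cong (false ∷_) (0^-+ m n)

0^-∷ʳ : ∀ m → 0^ m ∷ʳ false ≡ false ∷ 0^ m
0^-∷ʳ zero    = refl
0^-∷ʳ (suc m) = cong (false ∷_) (0^-∷ʳ m)

reverse-0^ : ∀ m → reverse (0^ m) ≡ 0^ m
reverse-0^ zero    = refl
reverse-0^ (suc m) = begin
  reverse (0^ (suc m))      ≡⟨ unfold-reverse false (0^ m) ⟩
  reverse (0^ m) ∷ʳ false   ≡⟨ cong (_∷ʳ false) (reverse-0^ m) ⟩
  0^ m ∷ʳ false             ≡⟨ 0^-∷ʳ m ⟩
  0^ (suc m)                ∎
  where open ≡-Reasoning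

0^-injective : ∀ {m n} → 0^ m ≡ 0^ n → m ≡ n
0^-injective {m} {n} eq = begin
  m              ≡⟨ length-replicate m ⟨
  length (0^ m)  ≡⟨ cong length eq ⟩
  length (0^ n)  ≡⟨ length-replicate n ⟩
  n              ∎
  where open ≡-Reasoning

∷-nonempty : ∀ xs {y : Letter} {ys} → xs ++ y ∷ ys ≢ []
∷-nonempty xs {y} {ys} eq with ++-conicalʳ xs (y ∷ ys) eq
... | ()

0^≢0^1 : ∀ i k {ys} → 0^ i ≢ 0^ k ++ true ∷ ys
0^≢0^1 zero    zero    ()
0^≢0^1 zero    (suc k) ()
0^≢0^1 (suc i) zero    ()
0^≢0^1 (suc i) (suc k) eq = 0^≢0^1 i k (∷-injectiveʳ eq)

0^1-injective : ∀ i j {xs ys} → 0^ i ++ true ∷ xs ≡ 0^ j ++ true ∷ ys → i ≡ j × xs ≡ ys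
0^1-injective zero    zero    eq = refl , ∷-injectiveʳ eq
0^1-injective (suc i) (suc j) eq with 0^1-injective i j (∷-injectiveʳ eq)
... | refl , xs≡ys = refl , xs≡ys

0^1-prefix-≤ : ∀ k j {xs ys} → 0^ k ++ true ∷ xs ≡ 0^ j ++ ys → j ≤ k
0^1-prefix-≤ k       zero    eq = z≤n
0^1-prefix-≤ (suc k) (suc j) eq = s≤s (0^1-prefix-≤ k j (∷-injectiveʳ eq))

data Last1View : Word → Set where
  zeros   : ∀ m → Last1View (0^ m)
  _·1·0^_ : ∀ xs m → Last1View (xs ++ true ∷ 0^ m)

last1View : ∀ xs → Last1View xs
last1View [] = zeros 0
last1View (x ∷ xs) with last1View xs
last1View (false ∷ _) | zeros m    = zeros (suc m)
last1View (true  ∷ _) | zeros m    = [] ·1·0^ m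
last1View (x     ∷ _) | ys ·1·0^ m = (x ∷ ys) ·1·0^ m

reverse-·1·0^ : ∀ xs m → reverse (xs ++ true ∷ 0^ m) ≡ 0^ m ++ true ∷ reverse xs
reverse-·1·0^ xs m = begin
  reverse (xs ++ true ∷ 0^ m)               ≡⟨ reverse-++ xs (true ∷ 0^ m) ⟩
  reverse (true ∷ 0^ m) ++ reverse xs       ≡⟨ cong (_++ reverse xs) (unfold-reverse true (0^ m)) ⟩
  (reverse (0^ m) ∷ʳ true) ++ reverse xs    ≡⟨ cong (λ t → (t ∷ʳ true) ++ reverse xs) (reverse-0^ m) ⟩
  (0^ m ∷ʳ true) ++ reverse xs              ≡⟨ ++-assoc (0^ m) [ true ] (reverse xs) ⟩
  0^ m ++ true ∷ reverse xs                 ∎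
  where open ≡-Reasoning

split-at-first-1 : ∀ k ys i {xs zs} → 0^ k ++ true ∷ xs ≡ ys ++ 0^ i ++ true ∷ zs →
  (i ≤ k × xs ≡ zs) ⊎ ∃[ ys′ ] (ys ≡ 0^ k ++ true ∷ ys′ × xs ≡ ys′ ++ 0^ i ++ true ∷ zs)
split-at-first-1 zero    []          zero    eq = inj₁ (z≤n , ∷-injectiveʳ eq)
split-at-first-1 zero    (true ∷ ys) i       eq = inj₂ (ys , refl , ∷-injectiveʳ eq)
split-at-first-1 (suc k) []          (suc i) eq with split-at-first-1 k [] i (∷-injectiveʳ eq)
... | inj₁ (i≤k , xs≡zs)     = inj₁ (s≤s i≤k , xs≡zs)
... | inj₂ (_ , []≡ , _)     = ⊥-elim (∷-nonempty (0^ k) (sym []≡))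
split-at-first-1 (suc k) (false ∷ ys) i      eq with split-at-first-1 k ys i (∷-injectiveʳ eq)
... | inj₁ (i≤k , xs≡zs)      = inj₁ (m≤n⇒m≤1+n i≤k , xs≡zs)
... | inj₂ (ys′ , ys≡ , xs≡)  = inj₂ (ys′ , cong (false ∷_) ys≡ , xs≡)

∷-as-∷ʳ : ∀ (x : Letter) xs → ∃[ ys ] ∃[ y ] x ∷ xs ≡ ys ∷ʳ y
∷-as-∷ʳ x []       = [] , x , refl
∷-as-∷ʳ x (x′ ∷ xs) with ∷-as-∷ʳ x′ xs
... | ys , y , eq = x ∷ ys , y , cong (x ∷_) eq

at-++ˡ : ∀ xs ys {i} → i < length xs → at (xs ++ ys) i ≡ at xs i
at-++ˡ (x ∷ xs) ys {zero}  _         = refl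
at-++ˡ (x ∷ xs) ys {suc i} (s≤s i<n) = at-++ˡ xs ys i<n

at-++ʳ : ∀ xs ys j → at (xs ++ ys) (length xs + j) ≡ at ys j
at-++ʳ []       ys j = refl
at-++ʳ (x ∷ xs) ys j = at-++ʳ xs ys j

applyUpTo-at : ∀ v (f : ℕ → Letter) → (∀ j → j < length v → f j ≡ at v j) → applyUpTo f (length v) ≡ v
applyUpTo-at []      f agree = refl
applyUpTo-at (x ∷ v) f agree =
  cong₂ _∷_ (agree 0 (s≤s z≤n)) (applyUpTo-at v (f ∘ suc) (λ j j<n → agree (suc j) (s≤s j<n)))

applyUpTo-prefix : ∀ L m (f : ℕ → Letter) → (∀ j → j < m → f j ≡ at L j) → m ≤ length L →
  ∃[ ys ] L ≡ applyUpTo f m ++ ys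
applyUpTo-prefix L       zero    f agree _         = L , refl
applyUpTo-prefix (x ∷ L) (suc m) f agree (s≤s m≤n)
  with applyUpTo-prefix L m (f ∘ suc) (λ j j<m → agree (suc j) (s≤s j<m)) m≤n
... | ys , eq = ys , cong₂ _∷_ (sym (agree 0 (s≤s z≤n))) eq

applyUpTo-infix : ∀ L k m (f : ℕ → Letter) → (∀ j → j < m → f j ≡ at L (k + j)) → k + m ≤ length L →
  ∃[ xs ] ∃[ ys ] L ≡ xs ++ applyUpTo f m ++ ys
applyUpTo-infix L zero m f agree k+m≤n with applyUpTo-prefix L m f agree k+m≤n
... | ys , eq = [] , ys , eq
applyUpTo-infix (x ∷ L) (suc k) m f agree (s≤s k+m≤n) with applyUpTo-infix L k m f agree k+m≤n
... | xs , ys , eq = x ∷ xs , ys , cong (x ∷_) eq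

module Substitution (a b : ℕ) (b<a : b < a) where

  Φ : Word → Word
  Φ = φ* a b

  zeroRun : Letter → ℕ
  zeroRun false = a
  zeroRun true  = b

  zeroRun≤a : ∀ c → zeroRun c ≤ a
  zeroRun≤a false = ≤-refl
  zeroRun≤a true  = <⇒≤ b<a

  b≤zeroRun : ∀ c → b ≤ zeroRun c
  b≤zeroRun false = <⇒≤ b<a
  b≤zeroRun true  = ≤-refl

  zeroRun-injective : ∀ c d → zeroRun c ≡ zeroRun d → c ≡ d
  zeroRun-injective false false _ = refl
  zeroRun-injective false true  a≡b = ⊥-elim (<⇒≢ b<a (sym a≡b))
  zeroRun-injective true  false b≡a = ⊥-elim (<⇒≢ b<a b≡a)
  zeroRun-injective true  true  _ = refl

  zeroRun>b⇒0 : ∀ c {i} → b < i → i ≤ zeroRun c → c ≡ false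
  zeroRun>b⇒0 false _   _   = refl
  zeroRun>b⇒0 true  b<i i≤b = ⊥-elim (<⇒≱ b<i i≤b)

  φ-zeroRun : ∀ c → φ a b c ≡ 0^ zeroRun c ++ [ true ]
  φ-zeroRun false = refl
  φ-zeroRun true  = refl

  φ-++ : ∀ c xs → φ a b c ++ xs ≡ 0^ zeroRun c ++ true ∷ xs
  φ-++ c xs rewrite φ-zeroRun c = ++-assoc (0^ zeroRun c) [ true ] xs

  Φ-∷ : ∀ c s → Φ (c ∷ s) ≡ 0^ zeroRun c ++ true ∷ Φ s
  Φ-∷ c s = φ-++ c (Φ s)

  Φ-++ : ∀ s t → Φ (s ++ t) ≡ Φ s ++ Φ t
  Φ-++ = concatMap-++ (φ a b)

  Φ-∷-∷ʳ : ∀ c w d → Φ (c ∷ w ∷ʳ d) ≡ 0^ zeroRun c ++ true ∷ Φ w ++ 0^ zeroRun d ++ [ true ]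
  Φ-∷-∷ʳ c w d = begin
    Φ (c ∷ w ∷ʳ d)                   ≡⟨ Φ-∷ c (w ∷ʳ d) ⟩
    0^ zeroRun c ++ true ∷ Φ (w ∷ʳ d) ≡⟨ cong (λ t → 0^ zeroRun c ++ true ∷ t) (Φ-++ w [ d ]) ⟩
    0^ zeroRun c ++ true ∷ Φ w ++ Φ [ d ] ≡⟨ cong (λ t → 0^ zeroRun c ++ true ∷ Φ w ++ t) (φ-++ d []) ⟩
    0^ zeroRun c ++ true ∷ Φ w ++ 0^ zeroRun d ++ [ true ] ∎
    where open ≡-Reasoning

  Φ-nonempty : ∀ s → Φ s ≡ [] → s ≡ []
  Φ-nonempty []      _   = refl
  Φ-nonempty (c ∷ s) eq = ⊥-elim (∷-nonempty (0^ zeroRun c) (trans (sym (Φ-∷ c s)) eq))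

  length-Φ : ∀ w → length w ≤ length (Φ w)
  length-Φ []      = z≤n
  length-Φ (c ∷ w) = begin
    suc (length w)                         ≤⟨ s≤s (length-Φ w) ⟩
    length (true ∷ Φ w)                    ≤⟨ m≤n+m _ (length (0^ zeroRun c)) ⟩
    length (0^ zeroRun c) + length (true ∷ Φ w) ≡⟨ length-++ (0^ zeroRun c) ⟨
    length (0^ zeroRun c ++ true ∷ Φ w)    ≡⟨ cong length (Φ-∷ c w) ⟨
    length (Φ (c ∷ w))                     ∎
    where open ≤-Reasoning

  Φ-split-after-1 : ∀ s xs i zs → Φ s ≡ xs ++ 0^ i ++ true ∷ zs →
    ∃[ s₁ ] ∃[ c ] ∃[ s₂ ] (s ≡ s₁ ++ c ∷ s₂ × i ≤ zeroRun c × Φ s₂ ≡ zs)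
  Φ-split-after-1 [] xs i zs eq =
    ⊥-elim (∷-nonempty (xs ++ 0^ i) (trans (++-assoc xs (0^ i) _) (sym eq)))
  Φ-split-after-1 (c ∷ s) xs i zs eq
    with split-at-first-1 (zeroRun c) xs i (trans (sym (Φ-∷ c s)) eq)
  ... | inj₁ (i≤c , Φs≡zs) = [] , c , s , refl , i≤c , Φs≡zs
  ... | inj₂ (xs′ , _ , Φs≡) with Φ-split-after-1 s xs′ i zs Φs≡
  ...   | s₁ , d , s₂ , refl , i≤d , Φs₂≡zs = c ∷ s₁ , d , s₂ , refl , i≤d , Φs₂≡zs

  Φ-∷-++ : ∀ c w zs → Φ (c ∷ w) ++ zs ≡ 0^ zeroRun c ++ true ∷ Φ w ++ zs
  Φ-∷-++ c w zs = trans (++-assoc (φ a b c) (Φ w) zs) (φ-++ c (Φ w ++ zs))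

  Φ-prefix : ∀ w s zs → Φ s ≡ Φ w ++ zs → ∃[ t ] (s ≡ w ++ t × Φ t ≡ zs)
  Φ-prefix []      s       zs eq = s , refl , eq
  Φ-prefix (c ∷ w) []      zs eq = ⊥-elim (∷-nonempty (0^ zeroRun c) (sym (trans eq (Φ-∷-++ c w zs))))
  Φ-prefix (c ∷ w) (d ∷ s) zs eq
    with 0^1-injective (zeroRun d) (zeroRun c) (trans (sym (Φ-∷ d s)) (trans eq (Φ-∷-++ c w zs)))
  ... | d≡c , Φs≡ with zeroRun-injective d c d≡c | Φ-prefix w s zs Φs≡
  ...   | refl | t , refl , Φt≡zs = t , refl , Φt≡zs

  Φ-injective : ∀ {s w} → Φ s ≡ Φ w → s ≡ w
  Φ-injective {s} {w} eq with Φ-prefix w s [] (trans eq (sym (++-identityʳ (Φ w))))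
  ... | t , refl , Φt≡[] rewrite Φ-nonempty t Φt≡[] = ++-identityʳ w

  Φ-leading-zeros-≤ : ∀ s j ys → Φ s ≡ 0^ j ++ ys → j ≤ a
  Φ-leading-zeros-≤ []      zero    ys eq = z≤n
  Φ-leading-zeros-≤ (c ∷ s) j       ys eq =
    ≤-trans (0^1-prefix-≤ (zeroRun c) j (trans (sym (Φ-∷ c s)) eq)) (zeroRun≤a c)

  Φ-zero-run-≤ : ∀ s xs j ys → Φ s ≡ xs ++ 0^ j ++ ys → j ≤ a
  Φ-zero-run-≤ s xs j ys = go s (last1View xs)
    where
    after-0^ : ∀ s m → Φ s ≡ 0^ m ++ 0^ j ++ ys → j ≤ a
    after-0^ s m eq = ≤-trans (m≤n+m j m) (Φ-leading-zeros-≤ s (m + j) ys (begin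
      Φ s                  ≡⟨ eq ⟩
      0^ m ++ 0^ j ++ ys   ≡⟨ ++-assoc (0^ m) (0^ j) ys ⟨
      (0^ m ++ 0^ j) ++ ys ≡⟨ cong (_++ ys) (0^-+ m j) ⟩
      0^ (m + j) ++ ys     ∎))
      where open ≡-Reasoning

    go : ∀ s {xs} → Last1View xs → Φ s ≡ xs ++ 0^ j ++ ys → j ≤ a
    go s (zeros m)     eq = after-0^ s m eq
    go s (xs ·1·0^ m) eq
      with Φ-split-after-1 s xs 0 (0^ m ++ 0^ j ++ ys) (trans eq (++-assoc xs (true ∷ 0^ m) (0^ j ++ ys)))
    ... | _ , _ , s₂ , _ , _ , Φs₂≡ = after-0^ s₂ m Φs₂≡

  Φ-isolated-zero-run : ∀ s xs i ys → Φ s ≡ xs ++ true ∷ 0^ i ++ true ∷ ys → i ≡ a ⊎ i ≡ b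
  Φ-isolated-zero-run s xs i ys eq with Φ-split-after-1 s xs 0 (0^ i ++ true ∷ ys) eq
  ... | _ , _ , []     , _ , _ , Φ[]≡ = ⊥-elim (∷-nonempty (0^ i) (sym Φ[]≡))
  ... | _ , _ , false ∷ s₂ , _ , _ , Φs₂≡ = inj₁ (sym (proj₁ (0^1-injective a i (trans (sym (Φ-∷ false s₂)) Φs₂≡))))
  ... | _ , _ , true  ∷ s₂ , _ , _ , Φs₂≡ = inj₂ (sym (proj₁ (0^1-injective b i (trans (sym (Φ-∷ true s₂)) Φs₂≡))))

  Φ-∷ʳ : ∀ w c → Φ (w ∷ʳ c) ≡ Φ w ++ 0^ zeroRun c ++ [ true ]
  Φ-∷ʳ w c = trans (Φ-++ w [ c ]) (cong (Φ w ++_) (φ-++ c []))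

  reverse-φ : ∀ c → reverse (φ a b c) ≡ true ∷ 0^ zeroRun c
  reverse-φ c rewrite φ-zeroRun c = trans (reverse-++ (0^ zeroRun c) [ true ]) (cong (true ∷_) (reverse-0^ (zeroRun c)))

  reverse-Φ : ∀ w → reverse (Φ w) ∷ʳ true ≡ true ∷ Φ (reverse w)
  reverse-Φ []      = refl
  reverse-Φ (c ∷ w) = begin
    reverse (φ a b c ++ Φ w) ∷ʳ true                ≡⟨ cong (_∷ʳ true) (reverse-++ (φ a b c) (Φ w)) ⟩
    (reverse (Φ w) ++ reverse (φ a b c)) ∷ʳ true    ≡⟨ cong (λ t → (reverse (Φ w) ++ t) ∷ʳ true) (reverse-φ c) ⟩
    (reverse (Φ w) ++ true ∷ 0^ zeroRun c) ∷ʳ true  ≡⟨ ++-assoc (reverse (Φ w)) (true ∷ 0^ zeroRun c) [ true ] ⟩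
    reverse (Φ w) ++ true ∷ 0^ zeroRun c ++ [ true ] ≡⟨ ++-assoc (reverse (Φ w)) [ true ] _ ⟨
    (reverse (Φ w) ∷ʳ true) ++ 0^ zeroRun c ++ [ true ] ≡⟨ cong (_++ 0^ zeroRun c ++ [ true ]) (reverse-Φ w) ⟩
    true ∷ Φ (reverse w) ++ 0^ zeroRun c ++ [ true ] ≡⟨ cong (true ∷_) (Φ-∷ʳ (reverse w) c) ⟨
    true ∷ Φ (reverse w ∷ʳ c)                       ≡⟨ cong (λ t → true ∷ Φ t) (unfold-reverse c w) ⟨
    true ∷ Φ (reverse (c ∷ w))                      ∎
    where open ≡-Reasoning

module Language (a b : ℕ) (b<a : b < a) (2≤a : 2 ≤ a) where
  open Substitution a b b<a
  open import Algebra.Solver.Monoid (++-monoid Letter) using (solve; _⊜_; _⊕_) renaming (id to ε)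

  Occurs : Word → Set
  Occurs v = ∃[ n ] ∃[ xs ] ∃[ ys ] φⁿ0 a b n ≡ xs ++ v ++ ys

  φⁿ0-starts-with-0 : ∀ n → ∃[ t ] φⁿ0 a b n ≡ false ∷ t
  φⁿ0-starts-with-0 zero = [] , refl
  φⁿ0-starts-with-0 (suc n) with φⁿ0-starts-with-0 n
  ... | t , eq = 0^ (a ∸ 1) ++ true ∷ Φ t , (begin
    Φ (φⁿ0 a b n)                   ≡⟨ cong Φ eq ⟩
    Φ (false ∷ t)                   ≡⟨ Φ-∷ false t ⟩
    0^ a ++ true ∷ Φ t              ≡⟨ cong (λ k → 0^ k ++ true ∷ Φ t) (m+[n∸m]≡n (≤-trans (s≤s z≤n) 2≤a)) ⟨
    false ∷ 0^ (a ∸ 1) ++ true ∷ Φ t ∎)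
    where open ≡-Reasoning

  φⁿ0-doubles : ∀ n → ∃[ r ] φⁿ0 a b (suc n) ≡ φⁿ0 a b n ++ φⁿ0 a b n ++ r
  φⁿ0-doubles zero = 0^ (a ∸ 2) ++ [ true ] , (begin
    φ a b false ++ []              ≡⟨ ++-identityʳ _ ⟩
    0^ a ++ [ true ]               ≡⟨ cong (λ k → 0^ k ++ [ true ]) (m+[n∸m]≡n 2≤a) ⟨
    0^ (2 + (a ∸ 2)) ++ [ true ]   ∎)
    where open ≡-Reasoning
  φⁿ0-doubles (suc n) with φⁿ0-doubles n
  ... | r , eq = Φ r , (begin
    Φ (φⁿ0 a b (suc n))                                ≡⟨ cong Φ eq ⟩
    Φ (φⁿ0 a b n ++ φⁿ0 a b n ++ r)                    ≡⟨ Φ-++ (φⁿ0 a b n) _ ⟩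
    φⁿ0 a b (suc n) ++ Φ (φⁿ0 a b n ++ r)              ≡⟨ cong (φⁿ0 a b (suc n) ++_) (Φ-++ (φⁿ0 a b n) r) ⟩
    φⁿ0 a b (suc n) ++ φⁿ0 a b (suc n) ++ Φ r          ∎)
    where open ≡-Reasoning

  φⁿ0-prefix : ∀ {m n} → m ≤′ n → ∃[ r ] φⁿ0 a b n ≡ φⁿ0 a b m ++ r
  φⁿ0-prefix ≤′-refl = [] , sym (++-identityʳ _)
  φⁿ0-prefix {m} {suc n} (≤′-step m≤′n) with φⁿ0-prefix m≤′n | φⁿ0-doubles n
  ... | r , eq | r′ , eq′ = r ++ φⁿ0 a b n ++ r′ , (begin
    φⁿ0 a b (suc n)                     ≡⟨ eq′ ⟩
    φⁿ0 a b n ++ φⁿ0 a b n ++ r′        ≡⟨ cong (_++ φⁿ0 a b n ++ r′) eq ⟩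
    (φⁿ0 a b m ++ r) ++ φⁿ0 a b n ++ r′ ≡⟨ ++-assoc (φⁿ0 a b m) r _ ⟩
    φⁿ0 a b m ++ r ++ φⁿ0 a b n ++ r′   ∎)
    where open ≡-Reasoning

  length-φⁿ0 : ∀ n → n < length (φⁿ0 a b n)
  length-φⁿ0 zero    = s≤s z≤n
  length-φⁿ0 (suc n) with φⁿ0-doubles n
  ... | r , eq = begin-strict
    suc n                                                ≤⟨ length-φⁿ0 n ⟩
    length (φⁿ0 a b n)                                   <⟨ m<m+n _ (≤-trans (s≤s z≤n) (length-φⁿ0 n)) ⟩
    length (φⁿ0 a b n) + length (φⁿ0 a b n)              ≤⟨ +-monoʳ-≤ (length (φⁿ0 a b n)) (m≤m+n _ (length r)) ⟩
    length (φⁿ0 a b n) + (length (φⁿ0 a b n) + length r) ≡⟨ cong (length (φⁿ0 a b n) +_) (length-++ (φⁿ0 a b n)) ⟨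
    length (φⁿ0 a b n) + length (φⁿ0 a b n ++ r)         ≡⟨ length-++ (φⁿ0 a b n) ⟨
    length (φⁿ0 a b n ++ φⁿ0 a b n ++ r)                 ≡⟨ cong length eq ⟨
    length (φⁿ0 a b (suc n))                             ∎
    where open ≤-Reasoning

  u-agrees : ∀ n i → i < length (φⁿ0 a b n) → u a b i ≡ at (φⁿ0 a b n) i
  u-agrees n i i<n with ≤-total n (suc i)
  ... | inj₁ n≤1+i with φⁿ0-prefix (≤⇒≤′ n≤1+i)
  ...   | r , eq = trans (cong (λ t → at t i) eq) (at-++ˡ (φⁿ0 a b n) r i<n)
  u-agrees n i i<n | inj₂ 1+i≤n with φⁿ0-prefix (≤⇒≤′ 1+i≤n)
  ...   | r , eq = sym (trans (cong (λ t → at t i) eq) (at-++ˡ (φⁿ0 a b (suc i)) r (<-trans (n<1+n i) (length-φⁿ0 (suc i)))))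

  Factor⇔Occurs : ∀ v → Factor a b v ⇔ Occurs v
  Factor⇔Occurs v = mk⇔ Factor⇒Occurs Occurs⇒Factor
    where
    Factor⇒Occurs : Factor a b v → Occurs v
    Factor⇒Occurs (k , eq) =
      let xs , ys , split = applyUpTo-infix (φⁿ0 a b N) k (length v) (λ j → u a b (k + j)) agree (<⇒≤ (length-φⁿ0 N))
      in  N , xs , ys , trans split (cong (λ t → xs ++ t ++ ys) (sym (trans eq (map-upTo _ (length v)))))
      where
      N : ℕ
      N = k + length v
      agree : ∀ j → j < length v → u a b (k + j) ≡ at (φⁿ0 a b N) (k + j)
      agree j j<v = u-agrees N (k + j) (<-trans (+-monoʳ-< k j<v) (length-φⁿ0 N))

    Occurs⇒Factor : Occurs v → Factor a b v
    Occurs⇒Factor (n , xs , ys , eq) = length xs , sym (trans (map-upTo _ (length v)) (applyUpTo-at v _ agree))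
      where
      inside : ∀ {j} → j < length v → length xs + j < length (φⁿ0 a b n)
      inside {j} j<v = begin-strict
        length xs + j                        <⟨ +-monoʳ-< (length xs) (<-≤-trans j<v (m≤m+n (length v) (length ys))) ⟩
        length xs + (length v + length ys)   ≡⟨ cong (length xs +_) (length-++ v) ⟨
        length xs + length (v ++ ys)         ≡⟨ length-++ xs ⟨
        length (xs ++ v ++ ys)               ≡⟨ cong length eq ⟨
        length (φⁿ0 a b n)                   ∎
        where open ≤-Reasoning

      agree : ∀ j → j < length v → u a b (length xs + j) ≡ at v j
      agree j j<v = begin
        u a b (length xs + j)                  ≡⟨ u-agrees n (length xs + j) (inside j<v) ⟩
        at (φⁿ0 a b n) (length xs + j)         ≡⟨ cong (λ t → at t (length xs + j)) eq ⟩
        at (xs ++ v ++ ys) (length xs + j)     ≡⟨ at-++ʳ xs (v ++ ys) j ⟩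
        at (v ++ ys) j                         ≡⟨ at-++ˡ v ys j<v ⟩
        at v j                                 ∎
        where open ≡-Reasoning

  -- Opaque so that type checking never normalises the reassociation proofs it transports.
  opaque
    Occurs-cong : ∀ {v v′} → v ≡ v′ → Occurs v ⇔ Occurs v′
    Occurs-cong refl = ⇔-refl

  Occurs-infix : ∀ xs v ys → Occurs (xs ++ v ++ ys) → Occurs v
  Occurs-infix xs v ys (n , xs′ , ys′ , eq) = n , xs′ ++ xs , ys ++ ys′ , trans eq
    (solve 5 (λ X x v y Y → X ⊕ (x ⊕ v ⊕ y) ⊕ Y ⊜ (X ⊕ x) ⊕ v ⊕ (y ⊕ Y)) refl xs′ xs v ys ys′)

  Occurs-suffix : ∀ xs v → Occurs (xs ++ v) → Occurs v
  Occurs-suffix xs v occ = Occurs-infix xs v [] (subst (λ t → Occurs (xs ++ t)) (sym (++-identityʳ v)) occ)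

  Occurs-Φ : ∀ {v} → Occurs v → Occurs (Φ v)
  Occurs-Φ {v} (n , xs , ys , eq) = suc n , Φ xs , Φ ys ,
    trans (cong Φ eq) (trans (Φ-++ xs (v ++ ys)) (cong (Φ xs ++_) (Φ-++ v ys)))

  Occurs-in-image : ∀ {v} → Occurs v → ∃[ s ] ∃[ xs ] ∃[ ys ] (Occurs s × Φ s ≡ xs ++ v ++ ys)
  Occurs-in-image {v} (n , xs , ys , eq) with φⁿ0-doubles n
  ... | r , eq′ = φⁿ0 a b n , xs , ys ++ φⁿ0 a b n ++ r , (n , [] , [] , sym (++-identityʳ _)) , (begin
    φⁿ0 a b (suc n)                   ≡⟨ eq′ ⟩
    φⁿ0 a b n ++ φⁿ0 a b n ++ r       ≡⟨ cong (_++ φⁿ0 a b n ++ r) eq ⟩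
    (xs ++ v ++ ys) ++ φⁿ0 a b n ++ r ≡⟨ ++-assoc xs (v ++ ys) _ ⟩
    xs ++ (v ++ ys) ++ φⁿ0 a b n ++ r ≡⟨ cong (xs ++_) (++-assoc v ys _) ⟩
    xs ++ v ++ ys ++ φⁿ0 a b n ++ r   ∎)
    where open ≡-Reasoning

  Occurs-∷ʳ : ∀ {v} → Occurs v → ∃[ d ] Occurs (v ∷ʳ d)
  Occurs-∷ʳ {v} (n , xs , d ∷ ys , eq) = d , n , xs , ys , trans eq (cong (xs ++_) (sym (++-assoc v [ d ] ys)))
  Occurs-∷ʳ {v} (n , xs , []     , eq) with φⁿ0-doubles n | φⁿ0-starts-with-0 n
  ... | r , eq₁ | t , eq₂ = false , suc n , xs , t ++ r , (begin
    φⁿ0 a b (suc n)                          ≡⟨ eq₁ ⟩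
    φⁿ0 a b n ++ φⁿ0 a b n ++ r              ≡⟨ cong₂ (λ p q → p ++ q ++ r) eq eq₂ ⟩
    (xs ++ v ++ []) ++ (false ∷ t) ++ r
      ≡⟨ solve 5 (λ x v z t r → (x ⊕ v ⊕ ε) ⊕ (z ⊕ t) ⊕ r ⊜ x ⊕ (v ⊕ z) ⊕ t ⊕ r) refl xs v [ false ] t r ⟩
    xs ++ (v ∷ʳ false) ++ t ++ r             ∎)
    where open ≡-Reasoning

  Occurs-∷ : ∀ {v} → Occurs v → ∃[ c ] Occurs (c ∷ v)
  Occurs-∷ {v} (n , xs , ys , eq) with φⁿ0-doubles n | φⁿ0-starts-with-0 n
  ... | r , eq₁ | t , eq₂ with ∷-as-∷ʳ false (t ++ xs)
  ...   | zs , c , eq₃ = c , suc n , zs , ys ++ r , (begin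
    φⁿ0 a b (suc n)                          ≡⟨ eq₁ ⟩
    φⁿ0 a b n ++ φⁿ0 a b n ++ r              ≡⟨ cong₂ (λ p q → p ++ q ++ r) eq₂ eq ⟩
    (false ∷ t) ++ (xs ++ v ++ ys) ++ r
      ≡⟨ solve 6 (λ z t x v y r → (z ⊕ t) ⊕ (x ⊕ v ⊕ y) ⊕ r ⊜ (z ⊕ t ⊕ x) ⊕ v ⊕ y ⊕ r) refl [ false ] t xs v ys r ⟩
    (false ∷ t ++ xs) ++ v ++ ys ++ r        ≡⟨ cong (_++ v ++ ys ++ r) eq₃ ⟩
    (zs ∷ʳ c) ++ v ++ ys ++ r                ≡⟨ ++-assoc zs [ c ] _ ⟩
    zs ++ (c ∷ v) ++ ys ++ r                 ∎)
    where open ≡-Reasoning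

  frame : ℕ → Word → ℕ → Word
  frame i w j = 0^ i ++ true ∷ Φ w ++ 0^ j

  Occurs-frame⁻ : ∀ i w j → Occurs (frame i w j) →
    ∃[ c ] ∃[ d ] (Occurs (c ∷ w ∷ʳ d) × i ≤ zeroRun c × j ≤ zeroRun d)
  Occurs-frame⁻ i w j occ with Occurs-∷ʳ occ
  ... | e , occ′ with Occurs-in-image occ′
  ... | s , xs , ys , occ-s , eq
    with Φ-split-after-1 s xs i (Φ w ++ 0^ j ++ e ∷ ys) (trans eq
           (solve 7 (λ x z o f z′ e y → x ⊕ ((z ⊕ o ⊕ f ⊕ z′) ⊕ e) ⊕ y ⊜ x ⊕ z ⊕ o ⊕ f ⊕ z′ ⊕ e ⊕ y)
                  refl xs (0^ i) [ true ] (Φ w) (0^ j) [ e ] ys))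
  ... | s₁ , c , s₂ , refl , i≤c , Φs₂≡ with Φ-prefix w s₂ (0^ j ++ e ∷ ys) Φs₂≡
  ... | []    , _    , Φ[]≡ = ⊥-elim (∷-nonempty (0^ j) (sym Φ[]≡))
  ... | d ∷ t , refl , Φt≡  = c , d ,
    Occurs-infix s₁ (c ∷ w ∷ʳ d) t (subst Occurs
      (solve 5 (λ s c w d t → s ⊕ c ⊕ w ⊕ d ⊕ t ⊜ s ⊕ (c ⊕ w ⊕ d) ⊕ t) refl s₁ [ c ] w [ d ] t) occ-s) ,
    i≤c , 0^1-prefix-≤ (zeroRun d) j (trans (sym (Φ-∷ d t)) Φt≡)

  Occurs-frame : ∀ {i j} c w d → Occurs (c ∷ w ∷ʳ d) → i ≤ zeroRun c → j ≤ zeroRun d → Occurs (frame i w j)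
  Occurs-frame {i} {j} c w d occ i≤c j≤d =
    Occurs-infix (0^ (zeroRun c ∸ i)) (frame i w j) (0^ (zeroRun d ∸ j) ++ [ true ]) (subst Occurs image (Occurs-Φ occ))
    where
    open ≡-Reasoning
    image : Φ (c ∷ w ∷ʳ d) ≡ 0^ (zeroRun c ∸ i) ++ frame i w j ++ 0^ (zeroRun d ∸ j) ++ [ true ]
    image = begin
      Φ (c ∷ w ∷ʳ d)
        ≡⟨ Φ-∷-∷ʳ c w d ⟩
      0^ zeroRun c ++ true ∷ Φ w ++ 0^ zeroRun d ++ [ true ]
        ≡⟨ cong₂ (λ x y → x ++ true ∷ Φ w ++ y ++ [ true ])
                 (trans (0^-+ (zeroRun c ∸ i) i) (cong 0^_ (m∸n+n≡m i≤c)))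
                 (trans (0^-+ j (zeroRun d ∸ j)) (cong 0^_ (m+[n∸m]≡n j≤d))) ⟨
      (0^ (zeroRun c ∸ i) ++ 0^ i) ++ true ∷ Φ w ++ (0^ j ++ 0^ (zeroRun d ∸ j)) ++ [ true ]
        ≡⟨ solve 7 (λ z′ z o f y y′ e → (z′ ⊕ z) ⊕ o ⊕ f ⊕ (y ⊕ y′) ⊕ e ⊜ z′ ⊕ (z ⊕ o ⊕ f ⊕ y) ⊕ y′ ⊕ e)
                 refl (0^ (zeroRun c ∸ i)) (0^ i) [ true ] (Φ w) (0^ j) (0^ (zeroRun d ∸ j)) [ true ] ⟩
      0^ (zeroRun c ∸ i) ++ frame i w j ++ 0^ (zeroRun d ∸ j) ++ [ true ]
        ∎

  Occurs-1Φ⇔ : ∀ v → Occurs (true ∷ Φ v) ⇔ Occurs v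
  Occurs-1Φ⇔ v = mk⇔ desubstitute substitute
    where
    desubstitute : Occurs (true ∷ Φ v) → Occurs v
    desubstitute occ with Occurs-in-image occ
    ... | s , xs , ys , occ-s , eq with Φ-split-after-1 s xs 0 (Φ v ++ ys) eq
    ... | s₁ , c , s₂ , refl , _ , Φs₂≡ with Φ-prefix v s₂ ys Φs₂≡
    ... | t , refl , _ = Occurs-infix (s₁ ∷ʳ c) v t (subst Occurs (sym (++-assoc s₁ [ c ] (v ++ t))) occ-s)

    substitute : Occurs v → Occurs (true ∷ Φ v)
    substitute occ with Occurs-∷ occ
    ... | c , occ′ = Occurs-suffix (0^ zeroRun c) (true ∷ Φ v) (subst Occurs (Φ-∷ c v) (Occurs-Φ occ′))

  Occurs-zero-run-≤ : ∀ xs j ys → Occurs (xs ++ 0^ j ++ ys) → j ≤ a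
  Occurs-zero-run-≤ xs j ys occ with Occurs-in-image occ
  ... | s , xs′ , ys′ , _ , eq = Φ-zero-run-≤ s (xs′ ++ xs) j (ys ++ ys′) (trans eq
    (solve 5 (λ X x z y Y → X ⊕ (x ⊕ z ⊕ y) ⊕ Y ⊜ (X ⊕ x) ⊕ z ⊕ y ⊕ Y) refl xs′ xs (0^ j) ys ys′))

  Occurs-isolated-zero-run : ∀ i ys → Occurs (true ∷ 0^ i ++ true ∷ ys) → i ≡ a ⊎ i ≡ b
  Occurs-isolated-zero-run i ys occ with Occurs-in-image occ
  ... | s , xs′ , ys′ , _ , eq = Φ-isolated-zero-run s xs′ i (ys ++ ys′) (trans eq
    (cong (λ t → xs′ ++ true ∷ t) (++-assoc (0^ i) (true ∷ ys) ys′)))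

  Occurs-1⋯1-image : ∀ m → Occurs (true ∷ m ∷ʳ true) → ∃[ w ] m ∷ʳ true ≡ Φ w
  Occurs-1⋯1-image m occ with Occurs-in-image occ
  ... | s , xs , ys , _ , eq with Φ-split-after-1 s xs 0 (m ++ true ∷ ys) (trans eq
        (cong (λ t → xs ++ true ∷ t) (++-assoc m [ true ] ys)))
  ... | _ , _ , s₂ , _ , _ , Φs₂≡ with Φ-split-after-1 s₂ m 0 ys Φs₂≡
  ... | t , c , t′ , refl , _ , Φt′≡ = t ∷ʳ c , sym (++-cancelʳ (Φ t′) (Φ (t ∷ʳ c)) (m ∷ʳ true) (begin
    Φ (t ∷ʳ c) ++ Φ t′      ≡⟨ Φ-++ (t ∷ʳ c) t′ ⟨
    Φ ((t ∷ʳ c) ++ t′)      ≡⟨ cong Φ (++-assoc t [ c ] t′) ⟩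
    Φ (t ++ c ∷ t′)         ≡⟨ Φs₂≡ ⟩
    m ++ true ∷ ys          ≡⟨ cong (λ y → m ++ true ∷ y) Φt′≡ ⟨
    m ++ true ∷ Φ t′        ≡⟨ ++-assoc m [ true ] (Φ t′) ⟨
    (m ∷ʳ true) ++ Φ t′     ∎))
    where open ≡-Reasoning

  Occurs-letter : ∀ c → Occurs [ c ]
  Occurs-letter false = 0 , [] , [] , refl
  Occurs-letter true  = 1 , 0^ a , [] , ++-assoc (0^ a) [ true ] []

  Occurs-0^⇔ : ∀ j → Occurs (0^ j) ⇔ j ≤ a
  Occurs-0^⇔ j = mk⇔ (λ occ → Occurs-zero-run-≤ [] j [] (subst Occurs (sym (++-identityʳ (0^ j))) occ)) occurs
    where
    occurs : j ≤ a → Occurs (0^ j)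
    occurs j≤a = Occurs-infix (0^ (a ∸ j)) (0^ j) [ true ] (subst Occurs (begin
      φ a b false ++ []                 ≡⟨ ++-identityʳ _ ⟩
      0^ a ++ [ true ]                  ≡⟨ cong (λ k → 0^ k ++ [ true ]) (m∸n+n≡m j≤a) ⟨
      0^ (a ∸ j + j) ++ [ true ]        ≡⟨ cong (_++ [ true ]) (0^-+ (a ∸ j) j) ⟨
      (0^ (a ∸ j) ++ 0^ j) ++ [ true ]  ≡⟨ ++-assoc (0^ (a ∸ j)) (0^ j) [ true ] ⟩
      0^ (a ∸ j) ++ 0^ j ++ [ true ]    ∎) (Occurs-Φ (Occurs-letter false)))
      where open ≡-Reasoning

module Palindromes (a b : ℕ) (b+1<a : b + 1 < a) where

  2+b≤a : 2 + b ≤ a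
  2+b≤a = subst (λ t → suc t ≤ a) (+-comm b 1) b+1<a

  b<a : b < a
  b<a = ≤-trans (n≤1+n _) 2+b≤a

  2≤a : 2 ≤ a
  2≤a = ≤-trans (s≤s (s≤s z≤n)) 2+b≤a

  open Substitution a b b<a
  open Language a b b<a 2≤a
  open Equivalence using (to; from)
  open import Algebra.Solver.Monoid (++-monoid Letter) using (solve; _⊜_; _⊕_)

  suc[a∸1]≡a : suc (a ∸ 1) ≡ a
  suc[a∸1]≡a = m+[n∸m]≡n (≤-trans (s≤s z≤n) 2≤a)

  2+m≤a⇔m<a∸1 : ∀ m → 2 + m ≤ a ⇔ m < a ∸ 1
  2+m≤a⇔m<a∸1 m = mk⇔ (λ 2+m≤a → ≤-pred (subst (2 + m ≤_) (sym suc[a∸1]≡a) 2+m≤a))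
                       (λ m<a∸1 → subst (2 + m ≤_) suc[a∸1]≡a (s≤s m<a∸1))

  b<a∸1 : b < a ∸ 1
  b<a∸1 = to (2+m≤a⇔m<a∸1 b) 2+b≤a

  a∸1<a : a ∸ 1 < a
  a∸1<a = subst (a ∸ 1 <_) suc[a∸1]≡a ≤-refl

  -- T a b w is wrap b w by definition.
  wrap : ℕ → Word → Word
  wrap i w = frame i w i

  Ext : Letter → Word → Set
  Ext z p = Occurs (z ∷ p ∷ʳ z)

  wrap-injective : ∀ i {w w′} → wrap i w ≡ wrap i w′ → w ≡ w′
  wrap-injective i eq = Φ-injective (++-cancelʳ (0^ i) _ _ (proj₂ (0^1-injective i i eq)))

  reverse-wrap : ∀ i w → reverse (wrap i w) ≡ wrap i (reverse w)
  reverse-wrap i w = begin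
    reverse (0^ i ++ true ∷ Φ w ++ 0^ i)                ≡⟨ reverse-++ (0^ i) (true ∷ Φ w ++ 0^ i) ⟩
    reverse (true ∷ Φ w ++ 0^ i) ++ reverse (0^ i)      ≡⟨ cong₂ _++_ (unfold-reverse true (Φ w ++ 0^ i)) (reverse-0^ i) ⟩
    (reverse (Φ w ++ 0^ i) ∷ʳ true) ++ 0^ i             ≡⟨ cong (λ t → (t ∷ʳ true) ++ 0^ i) (reverse-++ (Φ w) (0^ i)) ⟩
    ((reverse (0^ i) ++ reverse (Φ w)) ∷ʳ true) ++ 0^ i ≡⟨ cong (λ t → ((t ++ reverse (Φ w)) ∷ʳ true) ++ 0^ i) (reverse-0^ i) ⟩
    ((0^ i ++ reverse (Φ w)) ∷ʳ true) ++ 0^ i           ≡⟨ solve 4 (λ z r o z′ → ((z ⊕ r) ⊕ o) ⊕ z′ ⊜ z ⊕ (r ⊕ o) ⊕ z′)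
                                                              refl (0^ i) (reverse (Φ w)) [ true ] (0^ i) ⟩
    0^ i ++ (reverse (Φ w) ∷ʳ true) ++ 0^ i             ≡⟨ cong (λ t → 0^ i ++ t ++ 0^ i) (reverse-Φ w) ⟩
    0^ i ++ true ∷ Φ (reverse w) ++ 0^ i                ∎
    where open ≡-Reasoning

  palindrome-unwrap : ∀ i w → reverse (wrap i w) ≡ wrap i w → reverse w ≡ w
  palindrome-unwrap i w pal = wrap-injective i (trans (sym (reverse-wrap i w)) pal)

  length-wrap : ∀ i w → length w < length (wrap i w)
  length-wrap i w = begin-strict
    length w                                    ≤⟨ length-Φ w ⟩
    length (Φ w)                                ≤⟨ m≤m+n _ (length (0^ i)) ⟩
    length (Φ w) + length (0^ i)                ≡⟨ length-++ (Φ w) ⟨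
    length (Φ w ++ 0^ i)                        <⟨ n<1+n _ ⟩
    length (true ∷ Φ w ++ 0^ i)                 ≤⟨ m≤n+m _ (length (0^ i)) ⟩
    length (0^ i) + length (true ∷ Φ w ++ 0^ i) ≡⟨ length-++ (0^ i) ⟨
    length (wrap i w)                           ∎
    where open ≤-Reasoning

  wrap-of-occurring-1⋯1 : ∀ m ys → Occurs ((0^ m ++ true ∷ ys) ++ true ∷ 0^ m) →
    ∃[ w ] (0^ m ++ true ∷ ys) ++ true ∷ 0^ m ≡ wrap m w
  wrap-of-occurring-1⋯1 m ys occ = w , trans reassoc (cong (λ t → 0^ m ++ true ∷ t ++ 0^ m) ys1≡Φw)
    where
    reassoc : (0^ m ++ true ∷ ys) ++ true ∷ 0^ m ≡ 0^ m ++ (true ∷ ys ∷ʳ true) ++ 0^ m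
    reassoc = trans (++-assoc (0^ m) (true ∷ ys) (true ∷ 0^ m)) (cong (λ t → 0^ m ++ true ∷ t) (sym (++-assoc ys [ true ] (0^ m))))
    image : ∃[ w ] ys ∷ʳ true ≡ Φ w
    image = Occurs-1⋯1-image ys (Occurs-infix (0^ m) (true ∷ ys ∷ʳ true) (0^ m) (to (Occurs-cong reassoc) occ))
    w : Word
    w = proj₁ image
    ys1≡Φw : ys ∷ʳ true ≡ Φ w
    ys1≡Φw = proj₂ image

  palindrome-shape : ∀ p → reverse p ≡ p → Occurs p → (∃[ m ] p ≡ 0^ m) ⊎ (∃[ i ] ∃[ w ] p ≡ wrap i w)
  palindrome-shape p pal occ = shape (last1View p) pal occ
    where
    shape : ∀ {p} → Last1View p → reverse p ≡ p → Occurs p → (∃[ m ] p ≡ 0^ m) ⊎ (∃[ i ] ∃[ w ] p ≡ wrap i w)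
    shape (zeros m) _ _ = inj₁ (m , refl)
    shape (xs ·1·0^ m) pal occ with split-at-first-1 m xs 0 (trans (sym (reverse-·1·0^ xs m)) pal)
    ... | inj₁ (_ , reverse-xs≡0^m) = inj₂ (m , [] , (begin
      xs ++ true ∷ 0^ m           ≡⟨ pal ⟨
      reverse (xs ++ true ∷ 0^ m) ≡⟨ reverse-·1·0^ xs m ⟩
      0^ m ++ true ∷ reverse xs   ≡⟨ cong (λ t → 0^ m ++ true ∷ t) reverse-xs≡0^m ⟩
      wrap m []                   ∎))
      where open ≡-Reasoning
    ... | inj₂ (ys , refl , _) = inj₂ (m , wrap-of-occurring-1⋯1 m ys occ)

  Tⁿ : ℕ → Word → Word
  Tⁿ zero    w = w
  Tⁿ (suc n) w = T a b (Tⁿ n w)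

  Orbit : ℕ → Word → Set
  Orbit m p = ∃[ n ] p ≡ Tⁿ n (0^ m)

  Orbit-T : ∀ m w → Orbit m (T a b w) ⇔ Orbit m w
  Orbit-T m w = mk⇔ untwist (λ (n , eq) → suc n , cong (T a b) eq)
    where
    untwist : Orbit m (T a b w) → Orbit m w
    untwist (zero  , eq) = ⊥-elim (0^≢0^1 m b (sym eq))
    untwist (suc n , eq) = n , wrap-injective b eq

  Orbit-0^ : ∀ m i → Orbit m (0^ i) ⇔ i ≡ m
  Orbit-0^ m i = mk⇔ same-length (λ i≡m → 0 , cong 0^_ i≡m)
    where
    same-length : Orbit m (0^ i) → i ≡ m
    same-length (zero  , eq) = 0^-injective eq
    same-length (suc n , eq) = ⊥-elim (0^≢0^1 i b eq)

  ¬Orbit-wrap : ∀ m {i} w → i ≢ b → ¬ Orbit m (wrap i w)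
  ¬Orbit-wrap m {i} _ _   (zero  , eq) = 0^≢0^1 m i (sym eq)
  ¬Orbit-wrap m {i} _ i≢b (suc n , eq) = i≢b (proj₁ (0^1-injective i b eq))

  data Extensions (p : Word) : Set where
    none  : ¬ Ext false p → ¬ Ext true p → Orbit (a ∸ 1) p → ¬ Orbit b p → Extensions p
    both  : Ext false p → Ext true p → ¬ Orbit (a ∸ 1) p → Orbit b p → Extensions p
    only0 : Ext false p → ¬ Ext true p → ¬ Orbit (a ∸ 1) p → ¬ Orbit b p → Extensions p
    only1 : ¬ Ext false p → Ext true p → ¬ Orbit (a ∸ 1) p → ¬ Orbit b p → Extensions p

  Ext-0^-false⇔ : ∀ m → Ext false (0^ m) ⇔ m < a ∸ 1
  Ext-0^-false⇔ m = ⇔-trans (Occurs-cong (cong (false ∷_) (0^-∷ʳ m))) (⇔-trans (Occurs-0^⇔ (2 + m)) (2+m≤a⇔m<a∸1 m))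

  Ext-0^-true : ∀ c → Ext true (0^ zeroRun c)
  Ext-0^-true c = to (Occurs-cong (cong (true ∷_) (φ-++ c []))) (from (Occurs-1Φ⇔ [ c ]) (Occurs-letter c))

  Ext-true-0^1 : ∀ i ys → Ext true (0^ i ++ true ∷ ys) → i ≡ a ⊎ i ≡ b
  Ext-true-0^1 i ys ext = Occurs-isolated-zero-run i (ys ∷ʳ true)
    (to (Occurs-cong (cong (true ∷_) (++-assoc (0^ i) (true ∷ ys) [ true ]))) ext)

  Ext-wrap-false⇔ : ∀ i w → Ext false (wrap i w) ⇔ Occurs (wrap (suc i) w)
  Ext-wrap-false⇔ i w = Occurs-cong (cong (false ∷_) (begin
    (0^ i ++ true ∷ Φ w ++ 0^ i) ∷ʳ false ≡⟨ solve 5 (λ z o f z′ e → (z ⊕ o ⊕ f ⊕ z′) ⊕ e ⊜ z ⊕ o ⊕ f ⊕ (z′ ⊕ e))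
                                                refl (0^ i) [ true ] (Φ w) (0^ i) [ false ] ⟩
    0^ i ++ true ∷ Φ w ++ (0^ i ∷ʳ false) ≡⟨ cong (λ t → 0^ i ++ true ∷ Φ w ++ t) (0^-∷ʳ i) ⟩
    0^ i ++ true ∷ Φ w ++ false ∷ 0^ i    ∎))
    where open ≡-Reasoning

  Ext-wrap-true⇔ : ∀ c w → Ext true (wrap (zeroRun c) w) ⇔ Ext c w
  Ext-wrap-true⇔ c w = ⇔-trans (Occurs-cong (cong (true ∷_) (begin
    (0^ zeroRun c ++ true ∷ Φ w ++ 0^ zeroRun c) ∷ʳ true
      ≡⟨ solve 4 (λ z o f z′ → (z ⊕ o ⊕ f ⊕ z′) ⊕ o ⊜ z ⊕ o ⊕ f ⊕ z′ ⊕ o)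
               refl (0^ zeroRun c) [ true ] (Φ w) (0^ zeroRun c) ⟩
    0^ zeroRun c ++ true ∷ Φ w ++ 0^ zeroRun c ++ [ true ]
      ≡⟨ Φ-∷-∷ʳ c w c ⟨
    Φ (c ∷ w ∷ʳ c) ∎))) (Occurs-1Φ⇔ (c ∷ w ∷ʳ c))
    where open ≡-Reasoning

  Ext-T-false⇔ : ∀ w → Ext false (T a b w) ⇔ Ext false w
  Ext-T-false⇔ w = mk⇔ desubstitute (λ ext → from (Ext-wrap-false⇔ b w) (Occurs-frame false w false ext b<a b<a))
    where
    desubstitute : Ext false (T a b w) → Ext false w
    desubstitute ext =
      let c , d , occ , b<c , b<d = Occurs-frame⁻ (suc b) w (suc b) (to (Ext-wrap-false⇔ b w) ext)
      in subst₂ (λ c d → Occurs (c ∷ w ∷ʳ d)) (zeroRun>b⇒0 c ≤-refl b<c) (zeroRun>b⇒0 d ≤-refl b<d) occ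

  Extensions-T : ∀ {w} → Extensions w → Extensions (T a b w)
  Extensions-T {w} (none ¬e₀ ¬e₁ u ¬v)  = none (¬e₀ ∘ to (Ext-T-false⇔ w)) (¬e₁ ∘ to (Ext-wrap-true⇔ true w))
                                               (from (Orbit-T _ w) u) (¬v ∘ to (Orbit-T _ w))
  Extensions-T {w} (both e₀ e₁ ¬u v)    = both (from (Ext-T-false⇔ w) e₀) (from (Ext-wrap-true⇔ true w) e₁)
                                               (¬u ∘ to (Orbit-T _ w)) (from (Orbit-T _ w) v)
  Extensions-T {w} (only0 e₀ ¬e₁ ¬u ¬v) = only0 (from (Ext-T-false⇔ w) e₀) (¬e₁ ∘ to (Ext-wrap-true⇔ true w))
                                                (¬u ∘ to (Orbit-T _ w)) (¬v ∘ to (Orbit-T _ w))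
  Extensions-T {w} (only1 ¬e₀ e₁ ¬u ¬v) = only1 (¬e₀ ∘ to (Ext-T-false⇔ w)) (from (Ext-wrap-true⇔ true w) e₁)
                                                (¬u ∘ to (Orbit-T _ w)) (¬v ∘ to (Orbit-T _ w))

  ¬Ext-0^-true : ∀ {m} → m ≢ a → m ≢ b → ¬ Ext true (0^ m)
  ¬Ext-0^-true {m} m≢a m≢b = Sum.[ m≢a , m≢b ] ∘ Occurs-isolated-zero-run m []

  ¬Orbit-0^ : ∀ {m k} → m ≢ k → ¬ Orbit k (0^ m)
  ¬Orbit-0^ {m} {k} m≢k = m≢k ∘ to (Orbit-0^ k m)

  classify-0^ : ∀ m → Occurs (0^ m) → Extensions (0^ m)
  classify-0^ m occ with <-cmp m (a ∸ 1)
  ... | tri≈ _ refl _ = none (<-irrefl refl ∘ to (Ext-0^-false⇔ m)) (¬Ext-0^-true (<⇒≢ a∸1<a) (>⇒≢ b<a∸1))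
                             (from (Orbit-0^ _ m) refl) (¬Orbit-0^ (>⇒≢ b<a∸1))
  ... | tri< m<a∸1 _ _ with m ≟ b
  ...   | yes refl = both (from (Ext-0^-false⇔ m) m<a∸1) (Ext-0^-true true) (¬Orbit-0^ (<⇒≢ m<a∸1)) (from (Orbit-0^ _ m) refl)
  ...   | no m≢b   = only0 (from (Ext-0^-false⇔ m) m<a∸1) (¬Ext-0^-true (<⇒≢ (<-trans m<a∸1 a∸1<a)) m≢b)
                           (¬Orbit-0^ (<⇒≢ m<a∸1)) (¬Orbit-0^ m≢b)
  classify-0^ m occ | tri> _ _ a∸1<m
    with ≤-antisym (to (Occurs-0^⇔ m) occ) (subst (_≤ m) suc[a∸1]≡a a∸1<m)
  ... | refl = only1 (<-asym a∸1<a ∘ to (Ext-0^-false⇔ a)) (Ext-0^-true false)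
                     (¬Orbit-0^ (>⇒≢ a∸1<a)) (¬Orbit-0^ (>⇒≢ b<a))

  ¬Ext-wrap-true : ∀ {i} w → i ≢ a → i ≢ b → ¬ Ext true (wrap i w)
  ¬Ext-wrap-true {i} w i≢a i≢b = Sum.[ i≢a , i≢b ] ∘ Ext-true-0^1 i (Φ w ++ 0^ i)

  classify-wrap-only0 : ∀ {i} w → i ≢ a → i ≢ b → Occurs (wrap (suc i) w) → Extensions (wrap i w)
  classify-wrap-only0 {i} w i≢a i≢b occ =
    only0 (from (Ext-wrap-false⇔ i w) occ) (¬Ext-wrap-true w i≢a i≢b) (¬Orbit-wrap _ w i≢b) (¬Orbit-wrap _ w i≢b)

  classify-wrap-a : ∀ {w} → Ext false w → Extensions (wrap a w)
  classify-wrap-a {w} e₀ =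
    only1 ¬e₀ (from (Ext-wrap-true⇔ false w) e₀) (¬Orbit-wrap _ w (>⇒≢ b<a)) (¬Orbit-wrap _ w (>⇒≢ b<a))
    where
    ¬e₀ : ¬ Ext false (wrap a w)
    ¬e₀ ext = 1+n≰n (Occurs-zero-run-≤ [] (suc a) _ (to (Ext-wrap-false⇔ a w) ext))

  classify-wrap : ∀ i w → (Occurs w → Extensions w) → Occurs (wrap i w) → Extensions (wrap i w)
  classify-wrap i w classify-w occ with Occurs-frame⁻ i w i occ
  ... | c , d , occ-cwd , i≤c , i≤d with <-cmp i b
  ...   | tri< i<b _ _  = classify-wrap-only0 w (<⇒≢ (<-trans i<b b<a)) (<⇒≢ i<b)
                            (Occurs-frame c w d occ-cwd (≤-trans i<b (b≤zeroRun c)) (≤-trans i<b (b≤zeroRun d)))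
  ...   | tri≈ _ refl _ = Extensions-T (classify-w (Occurs-infix [ c ] w [ d ] occ-cwd))
  ...   | tri> _ _ b<i with zeroRun>b⇒0 c b<i i≤c | zeroRun>b⇒0 d b<i i≤d | i ≟ a
  ...     | refl | refl | yes refl = classify-wrap-a occ-cwd
  ...     | refl | refl | no i≢a   = classify-wrap-only0 w i≢a (>⇒≢ b<i) (Occurs-frame false w false occ-cwd i<a i<a)
    where
    i<a : i < a
    i<a = ≤∧≢⇒< i≤c i≢a

  classify : ∀ p → reverse p ≡ p → Occurs p → Extensions p
  classify p = classify-acc p (<-wellFounded (length p))
    where
    classify-acc : ∀ p → Acc _<_ (length p) → reverse p ≡ p → Occurs p → Extensions p
    classify-acc p (acc shorter) pal occ with palindrome-shape p pal occ
    ... | inj₁ (m , refl)     = classify-0^ m occ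
    ... | inj₂ (i , w , refl) =
      classify-wrap i w (classify-acc w (shorter (length-wrap i w)) (palindrome-unwrap i w pal)) occ

  classify-factor : ∀ p → IsPalindrome p → Factor a b p → Extensions p
  classify-factor p pal fac = classify p pal (to (Factor⇔Occurs p) fac)

  PalExt⇔Ext : ∀ z p → PalExt a b z p ⇔ Ext z p
  PalExt⇔Ext z p = Factor⇔Occurs (z ∷ p ∷ʳ z)

  Maximal⇔ : ∀ p → Maximal a b p ⇔ (¬ Ext false p × ¬ Ext true p)
  Maximal⇔ p = mk⇔ (λ max → (λ e → max (false , from (PalExt⇔Ext false p) e))
                          , (λ e → max (true , from (PalExt⇔Ext true p) e)))
                   (λ { (¬e₀ , _) (false , x) → ¬e₀ (to (PalExt⇔Ext false p) x)
                      ; (_ , ¬e₁) (true  , x) → ¬e₁ (to (PalExt⇔Ext true p) x) })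

  in-orbit⇔ : ∀ m (X : ℕ → Word) → (∀ n → X (suc n) ≡ Tⁿ n (0^ m)) →
              ∀ p → (∃[ n ] (1 ≤ n × p ≡ X n)) ⇔ Orbit m p
  in-orbit⇔ m X X≡Tⁿ p = mk⇔ (λ { (suc n , _ , eq) → n , trans eq (X≡Tⁿ n) })
                              (λ (n , eq) → suc n , s≤s z≤n , trans eq (sym (X≡Tⁿ n)))

  U≡Tⁿ : ∀ n → U a b (suc n) ≡ Tⁿ n (0^ (a ∸ 1))
  U≡Tⁿ zero    = refl
  U≡Tⁿ (suc n) = cong (T a b) (U≡Tⁿ n)

  V≡Tⁿ : ∀ n → V a b (suc n) ≡ Tⁿ n (0^ b)
  V≡Tⁿ zero    = refl
  V≡Tⁿ (suc n) = cong (T a b) (V≡Tⁿ n)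

  U⇔Orbit : ∀ p → (∃[ n ] (1 ≤ n × p ≡ U a b n)) ⇔ Orbit (a ∸ 1) p
  U⇔Orbit = in-orbit⇔ (a ∸ 1) (U a b) U≡Tⁿ

  V⇔Orbit : ∀ p → (∃[ n ] (1 ≤ n × p ≡ V a b n)) ⇔ Orbit b p
  V⇔Orbit = in-orbit⇔ b (V a b) V≡Tⁿ

  neither⇔ : ∀ p → ((n : ℕ) → 1 ≤ n → p ≢ U a b n × p ≢ V a b n) ⇔ (¬ Orbit (a ∸ 1) p × ¬ Orbit b p)
  neither⇔ p = ⇔-trans (mk⇔ split join) (¬-cong-⇔ (U⇔Orbit p) ×-⇔ ¬-cong-⇔ (V⇔Orbit p))
    where
    split : ((n : ℕ) → 1 ≤ n → p ≢ U a b n × p ≢ V a b n) →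
            ¬ (∃[ n ] (1 ≤ n × p ≡ U a b n)) × ¬ (∃[ n ] (1 ≤ n × p ≡ V a b n))
    split h = (λ (n , 1≤n , eq) → proj₁ (h n 1≤n) eq) , (λ (n , 1≤n , eq) → proj₂ (h n 1≤n) eq)
    join : ¬ (∃[ n ] (1 ≤ n × p ≡ U a b n)) × ¬ (∃[ n ] (1 ≤ n × p ≡ V a b n)) →
           (n : ℕ) → 1 ≤ n → p ≢ U a b n × p ≢ V a b n
    join (¬u , ¬v) n 1≤n = (λ eq → ¬u (n , 1≤n , eq)) , (λ eq → ¬v (n , 1≤n , eq))

  holds⇔holds : ∀ {A B : Set} → A → B → A ⇔ B
  holds⇔holds x y = mk⇔ (λ _ → y) (λ _ → x)

  fails⇔fails : ∀ {A B : Set} → ¬ A → ¬ B → A ⇔ B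
  fails⇔fails ¬x ¬y = mk⇔ (⊥-elim ∘ ¬x) (⊥-elim ∘ ¬y)

  none⇔Orbit : ∀ {p} → Extensions p → (¬ Ext false p × ¬ Ext true p) ⇔ Orbit (a ∸ 1) p
  none⇔Orbit (none ¬e₀ ¬e₁ u _)   = holds⇔holds (¬e₀ , ¬e₁) u
  none⇔Orbit (both e₀ _ ¬u _)     = fails⇔fails (λ (¬e₀ , _) → ¬e₀ e₀) ¬u
  none⇔Orbit (only0 e₀ _ ¬u _)    = fails⇔fails (λ (¬e₀ , _) → ¬e₀ e₀) ¬u
  none⇔Orbit (only1 _ e₁ ¬u _)    = fails⇔fails (λ (_ , ¬e₁) → ¬e₁ e₁) ¬u

  both⇔Orbit : ∀ {p} → Extensions p → (Ext false p × Ext true p) ⇔ Orbit b p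
  both⇔Orbit (none ¬e₀ _ _ ¬v)    = fails⇔fails (¬e₀ ∘ proj₁) ¬v
  both⇔Orbit (both e₀ e₁ _ v)     = holds⇔holds (e₀ , e₁) v
  both⇔Orbit (only0 _ ¬e₁ _ ¬v)   = fails⇔fails (¬e₁ ∘ proj₂) ¬v
  both⇔Orbit (only1 ¬e₀ _ _ ¬v)   = fails⇔fails (¬e₀ ∘ proj₁) ¬v

  one⇔¬Orbit : ∀ {p} → Extensions p →
    ((Ext false p × ¬ Ext true p) ⊎ (¬ Ext false p × Ext true p)) ⇔ (¬ Orbit (a ∸ 1) p × ¬ Orbit b p)
  one⇔¬Orbit (none ¬e₀ ¬e₁ u _)     = fails⇔fails (Sum.[ ¬e₀ ∘ proj₁ , ¬e₁ ∘ proj₂ ]) (λ (¬u , _) → ¬u u)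
  one⇔¬Orbit (both e₀ e₁ _ v)       = fails⇔fails (Sum.[ (λ (_ , ¬e₁) → ¬e₁ e₁) , (λ (¬e₀ , _) → ¬e₀ e₀) ])
                                                  (λ (_ , ¬v) → ¬v v)
  one⇔¬Orbit (only0 e₀ ¬e₁ ¬u ¬v)   = holds⇔holds (inj₁ (e₀ , ¬e₁)) (¬u , ¬v)
  one⇔¬Orbit (only1 ¬e₀ e₁ ¬u ¬v)   = holds⇔holds (inj₂ (¬e₀ , e₁)) (¬u , ¬v)

  maximal⇔U : ∀ {p} → Extensions p → Maximal a b p ⇔ (∃[ n ] (1 ≤ n × p ≡ U a b n))
  maximal⇔U {p} ext = ⇔-trans (Maximal⇔ p) (⇔-trans (none⇔Orbit ext) (⇔-sym (U⇔Orbit p)))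

  two⇔V : ∀ {p} → Extensions p → (PalExt a b false p × PalExt a b true p) ⇔ (∃[ n ] (1 ≤ n × p ≡ V a b n))
  two⇔V {p} ext = ⇔-trans (PalExt⇔Ext false p ×-⇔ PalExt⇔Ext true p) (⇔-trans (both⇔Orbit ext) (⇔-sym (V⇔Orbit p)))

  one⇔neither : ∀ {p} → Extensions p →
    ((PalExt a b false p × ¬ PalExt a b true p) ⊎ (¬ PalExt a b false p × PalExt a b true p))
    ⇔ ((n : ℕ) → 1 ≤ n → (p ≢ U a b n × p ≢ V a b n))
  one⇔neither {p} ext =
    ⇔-trans ((e₀ ×-⇔ ¬-cong-⇔ e₁) ⊎-⇔ (¬-cong-⇔ e₀ ×-⇔ e₁)) (⇔-trans (one⇔¬Orbit ext) (⇔-sym (neither⇔ p)))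
    where
    e₀ : PalExt a b false p ⇔ Ext false p
    e₀ = PalExt⇔Ext false p
    e₁ : PalExt a b true p ⇔ Ext true p
    e₁ = PalExt⇔Ext true p

proposition5p6 : (a b : ℕ) → 1 ≤ b → b + 1 < a → (p : Word) → IsPalindrome p → Factor a b p →
    (Maximal a b p ⇔ (∃[ n ] (1 ≤ n × p ≡ U a b n)))
    × ((PalExt a b false p × PalExt a b true p) ⇔ (∃[ n ] (1 ≤ n × p ≡ V a b n)))
    × (((PalExt a b false p × ¬ PalExt a b true p) ⊎ (¬ PalExt a b false p × PalExt a b true p))
       ⇔ ((n : ℕ) → 1 ≤ n → (p ≢ U a b n × p ≢ V a b n)))
proposition5p6 a b _ b+1<a p pal factor = maximal⇔U ext , two⇔V ext , one⇔neither ext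
  where
  open Palindromes a b b+1<a
  ext : Extensions p
  ext = classify-factor p pal factor
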